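{- Let $\mathbf{f}$ be the Fibonacci word and let $\mathbf{cubes_f}$ be the infinite binary word whose $n$-th term ($n\ge 0$) is $1$ if a cube ends at position $n$ of $\mathbf{f}$ and $0$ otherwise. Then the density of $0$'s in $\mathbf{cubes_f}$ is zero, i.e., \[ \lim_{N\to\infty}\frac{\#\{0\le n<N : \text{the $n$-th term of } \mathbf{cubes_f} \text{ is } 0\}}{N}=0. \]
   Context: The Fibonacci word is $\mathbf{f}=010010100100101001010010\cdots$, the fixed point of the morphism $0\mapsto 01$, $1\mapsto 0$; its letters are indexed starting from position $0$, and $\mathbf{f}[a..b]$ denotes the factor occupying positions $a$ through $b$. A cube is a word of the form $xxx$ with $x$ nonempty. A cube ends at position $j$ of $\mathbf{f}$ if there exist $i\ge 0$ and $m\ge 1$ with $j=i+3m-1$ such that $\mathbf{f}[i..j]=xxx$ for some word $x$ of length $m$. -}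

module Defs where

open import Data.Bool using (Bool; true; false; not; if_then_else_)
open import Data.Nat using (ℕ; zero; suc; _+_; _*_; _≤_; _<_)
open import Data.List using (List; []; _∷_; _++_; concatMap; map; upTo; length)
open import Data.Product using (Σ; _×_)
open import Relation.Binary.PropositionalEquality using (_≡_)

-- Letters: the letter 0 is `false`, the letter 1 is `true`.

φ : Bool → List Bool
φ false = false ∷ true ∷ []
φ true  = false ∷ []

φ* : List Bool → List Bool
φ* = concatMap φ

iterφ : ℕ → List Bool
iterφ zero    = false ∷ []
iterφ (suc n) = φ* (iterφ n)

-- n-th letter of a list (0-indexed), default 0 (never used below)
nth : List Bool → ℕ → Bool
nth []       _       = false
nth (x ∷ xs) zero    = x
nth (x ∷ xs) (suc n) = nth xs n

-- The Fibonacci word f, indexed from 0.  φⁿ(0) is a prefix of the fixed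
-- point of length F_{n+2} ≥ n+1, so position n is read from φ^{n+1}(0).
fibWord : ℕ → Bool
fibWord n = nth (iterφ (suc n)) n

factor : ℕ → ℕ → List Bool
factor i len = map (λ t → fibWord (i + t)) (upTo len)

CubeEndsAt : ℕ → Set
CubeEndsAt j =
  Σ ℕ λ i → Σ ℕ λ m → (1 ≤ m) × (j + 1 ≡ i + 3 * m) ×
    (Σ (List Bool) λ x → (length x ≡ m) × (factor i (3 * m) ≡ x ++ x ++ x))

zerosBelow : (ℕ → Bool) → ℕ → ℕ
zerosBelow c zero    = 0
zerosBelow c (suc N) = zerosBelow c N + (if c N then 0 else 1)

-- Since f = φ(f), f is cut into blocks φ^m(f v), and each v is the last letter of
-- one of the five factors of length 4 of f.  When that factor is 0010, the word
-- φ^(n+2)(0010) = AABA, with A = φ^(n+2)(0) and B = φ^(n+1)(0), has period |A| up to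
-- its last two letters, because AB and BA differ only there; so after its first
-- φ^n(0) the block φ^(n+2)(0) consists of ends of cubes except for its last two letters.
-- Following the blocks down through the five factors then bounds the zeros of
-- cubes_f in a block of depth m by (m+1)², while its length is a Fibonacci number.
module Submission where

open import Defs
open import Data.Bool using (Bool; true; false; if_then_else_)
open import Data.Empty using (⊥-elim)
open import Data.List using (List; []; _∷_; _++_; length; applyUpTo)
open import Data.List.Properties using (length-++; concatMap-++; ++-assoc; length-applyUpTo; map-upTo)
open import Data.Nat
open import Data.Nat.Induction using (<-rec)
open import Data.Nat.Properties
open import Data.Nat.Tactic.RingSolver using (solve-∀)
open import Data.Product using (Σ; _×_; _,_; proj₁; proj₂)
open import Data.Sum using (inj₁; inj₂)
open import Function.Bundles using (_⇔_; Equivalence)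
open import Relation.Nullary using (yes; no)
open import Relation.Nullary.Decidable using (toWitness)
open import Relation.Binary.PropositionalEquality

nth-++ˡ : ∀ (a b : List Bool) {i} → i < length a → nth (a ++ b) i ≡ nth a i
nth-++ˡ (x ∷ a) b {zero}  _        = refl
nth-++ˡ (x ∷ a) b {suc i} (s≤s i<) = nth-++ˡ a b i<

nth-++ʳ : ∀ (a b : List Bool) i → nth (a ++ b) (length a + i) ≡ nth b i
nth-++ʳ []      b i = refl
nth-++ʳ (x ∷ a) b i = nth-++ʳ a b i

nth-prefix : ∀ {w} (q r : List Bool) {i} → w ≡ q ++ r → i < length q → nth w i ≡ nth q i
nth-prefix q r refl i< = nth-++ˡ q r i<

applyUpTo-+ : ∀ (h : ℕ → Bool) a b →
  applyUpTo h (a + b) ≡ applyUpTo h a ++ applyUpTo (λ t → h (a + t)) b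
applyUpTo-+ h zero    b = refl
applyUpTo-+ h (suc a) b = cong (h 0 ∷_) (applyUpTo-+ (λ t → h (suc t)) a b)

applyUpTo-cong : ∀ {h h' : ℕ → Bool} n → (∀ t → t < n → h t ≡ h' t) →
  applyUpTo h n ≡ applyUpTo h' n
applyUpTo-cong zero    _  = refl
applyUpTo-cong (suc n) eq = cong₂ _∷_ (eq 0 z<s) (applyUpTo-cong n (λ t t< → eq (suc t) (s<s t<)))

-- Finite Fibonacci words

φ*-++ : ∀ a b → φ* (a ++ b) ≡ φ* a ++ φ* b
φ*-++ = concatMap-++ φ

-- Iterated from the inside, so that φ^ (suc m) (true ∷ []) reduces to φ^ m (false ∷ []).
φ^ : ℕ → List Bool → List Bool
φ^ zero    w = w
φ^ (suc m) w = φ^ m (φ* w)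

φ^-suc : ∀ m w → φ^ (suc m) w ≡ φ* (φ^ m w)
φ^-suc zero    w = refl
φ^-suc (suc m) w = φ^-suc m (φ* w)

φ^-++ : ∀ m a b → φ^ m (a ++ b) ≡ φ^ m a ++ φ^ m b
φ^-++ zero    a b = refl
φ^-++ (suc m) a b = trans (cong (φ^ m) (φ*-++ a b)) (φ^-++ m (φ* a) (φ* b))

length-φ^-∷ : ∀ m a w → length (φ^ m (a ∷ w)) ≡ length (φ^ m (a ∷ [])) + length (φ^ m w)
length-φ^-∷ m a w = trans (cong length (φ^-++ m (a ∷ []) w)) (length-++ (φ^ m (a ∷ [])))

-- fibLen m = F_{m+2}
fibLen : ℕ → ℕ
fibLen zero          = 1
fibLen (suc zero)    = 2
fibLen (suc (suc m)) = fibLen (suc m) + fibLen m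

fibPrefix : ℕ → List Bool
fibPrefix m = φ^ m (false ∷ [])

fibPrefix-suc-suc : ∀ m → fibPrefix (suc (suc m)) ≡ fibPrefix (suc m) ++ fibPrefix m
fibPrefix-suc-suc m = φ^-++ (suc m) (false ∷ []) (true ∷ [])

length-fibPrefix : ∀ m → length (fibPrefix m) ≡ fibLen m
length-fibPrefix zero          = refl
length-fibPrefix (suc zero)    = refl
length-fibPrefix (suc (suc m)) =
  trans (cong length (fibPrefix-suc-suc m))
    (trans (length-++ (fibPrefix (suc m))) (cong₂ _+_ (length-fibPrefix (suc m)) (length-fibPrefix m)))

fibPrefix-swap : ∀ m → Σ (List Bool) λ q → Σ Bool λ a → Σ Bool λ b →
  (fibPrefix (suc m) ++ fibPrefix m ≡ q ++ a ∷ b ∷ []) ×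
  (fibPrefix m ++ fibPrefix (suc m) ≡ q ++ b ∷ a ∷ [])
fibPrefix-swap zero = false ∷ [] , true , false , refl , refl
fibPrefix-swap (suc m) with fibPrefix-swap m
... | q , a , b , AB , BA = A ++ q , b , a , A'B' , B'A'
  where
  open ≡-Reasoning
  A = fibPrefix (suc m)
  B = fibPrefix m
  A'B' : fibPrefix (suc (suc m)) ++ A ≡ (A ++ q) ++ b ∷ a ∷ []
  A'B' = begin
    fibPrefix (suc (suc m)) ++ A ≡⟨ cong (_++ A) (fibPrefix-suc-suc m) ⟩
    (A ++ B) ++ A                ≡⟨ ++-assoc A B A ⟩
    A ++ (B ++ A)                ≡⟨ cong (A ++_) BA ⟩
    A ++ (q ++ b ∷ a ∷ [])       ≡⟨ ++-assoc A q _ ⟨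
    (A ++ q) ++ b ∷ a ∷ []       ∎
  B'A' : A ++ fibPrefix (suc (suc m)) ≡ (A ++ q) ++ a ∷ b ∷ []
  B'A' = begin
    A ++ fibPrefix (suc (suc m)) ≡⟨ cong (A ++_) (fibPrefix-suc-suc m) ⟩
    A ++ (A ++ B)                ≡⟨ cong (A ++_) AB ⟩
    A ++ (q ++ a ∷ b ∷ [])       ≡⟨ ++-assoc A q _ ⟨
    (A ++ q) ++ a ∷ b ∷ []       ∎

fibLen-pos : ∀ n → 1 ≤ fibLen n
fibLen-pos zero          = s≤s z≤n
fibLen-pos (suc zero)    = s≤s z≤n
fibLen-pos (suc (suc n)) = ≤-trans (fibLen-pos (suc n)) (m≤m+n _ _)

fibLen-suc-≥ : ∀ n → fibLen n ≤ fibLen (suc n)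
fibLen-suc-≥ zero    = s≤s z≤n
fibLen-suc-≥ (suc n) = m≤m+n _ _

fibLen-+-≥ : ∀ d n → fibLen n ≤ fibLen (d + n)
fibLen-+-≥ zero    n = ≤-refl
fibLen-+-≥ (suc d) n = ≤-trans (fibLen-+-≥ d n) (fibLen-suc-≥ (d + n))

n<fibLen : ∀ n → n < fibLen n
n<fibLen zero          = z<s
n<fibLen (suc zero)    = s<s z<s
n<fibLen (suc (suc n)) =
  ≤-trans (≤-reflexive (+-comm 1 (suc (suc n)))) (+-mono-≤ (n<fibLen (suc n)) (fibLen-pos n))

length-φ^-letter : ∀ m a →
  fibLen m ≤ length (φ^ (suc m) (a ∷ [])) × length (φ^ (suc m) (a ∷ [])) ≤ fibLen (suc m)
length-φ^-letter m false =
  subst (fibLen m ≤_) (sym (length-fibPrefix (suc m))) (fibLen-suc-≥ m) ,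
  ≤-reflexive (length-fibPrefix (suc m))
length-φ^-letter m true =
  ≤-reflexive (sym (length-fibPrefix m)) ,
  subst (_≤ fibLen (suc m)) (sym (length-fibPrefix m)) (fibLen-suc-≥ m)

nth-fibPrefix-suc : ∀ n {i} → i < fibLen n → nth (fibPrefix (suc n)) i ≡ nth (fibPrefix n) i
nth-fibPrefix-suc zero    {zero}  _ = refl
nth-fibPrefix-suc zero    {suc i} (s≤s ())
nth-fibPrefix-suc (suc n) i< =
  nth-prefix (fibPrefix (suc n)) (fibPrefix n) (fibPrefix-suc-suc n)
    (subst (_ <_) (sym (length-fibPrefix (suc n))) i<)

nth-fibPrefix-+ : ∀ d n {i} → i < fibLen n → nth (fibPrefix (d + n)) i ≡ nth (fibPrefix n) i
nth-fibPrefix-+ zero    n _  = refl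
nth-fibPrefix-+ (suc d) n i< =
  trans (nth-fibPrefix-suc (d + n) (<-≤-trans i< (fibLen-+-≥ d n))) (nth-fibPrefix-+ d n i<)

iterφ≡fibPrefix : ∀ n → iterφ n ≡ fibPrefix n
iterφ≡fibPrefix zero    = refl
iterφ≡fibPrefix (suc n) = trans (cong φ* (iterφ≡fibPrefix n)) (sym (φ^-suc n (false ∷ [])))

fibWord-fibPrefix : ∀ n {i} → i < fibLen n → fibWord i ≡ nth (fibPrefix n) i
fibWord-fibPrefix n {i} i< = begin
  fibWord i                        ≡⟨ cong (λ w → nth w i) (iterφ≡fibPrefix (suc i)) ⟩
  nth (fibPrefix (suc i)) i        ≡⟨ nth-fibPrefix-+ n (suc i) (<-trans (n<1+n i) (n<fibLen (suc i))) ⟨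
  nth (fibPrefix (n + suc i)) i    ≡⟨ cong (λ k → nth (fibPrefix k) i) (+-comm n (suc i)) ⟩
  nth (fibPrefix (suc i + n)) i    ≡⟨ nth-fibPrefix-+ (suc i) n i< ⟩
  nth (fibPrefix n) i              ∎
  where open ≡-Reasoning

-- The fixed point f = φ(f)

φLength : (ℕ → Bool) → ℕ → ℕ
φLength g zero    = 0
φLength g (suc u) = length (φ (g 0)) + φLength (λ t → g (suc t)) u

-- φpos u is the position of the block φ(f u) in φ(f) = f.
φpos : ℕ → ℕ
φpos = φLength fibWord

1≤length-φ : ∀ a → 1 ≤ length (φ a)
1≤length-φ false = s≤s z≤n
1≤length-φ true  = s≤s z≤n

φLength-suc : ∀ g u → φLength g (suc u) ≡ φLength g u + length (φ (g u))
φLength-suc g zero    = +-comm _ 0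
φLength-suc g (suc u) =
  trans (cong (length (φ (g 0)) +_) (φLength-suc (λ t → g (suc t)) u))
    (sym (+-assoc (length (φ (g 0))) _ _))

φLength-cong : ∀ {g h} u → (∀ t → t < u → g t ≡ h t) → φLength g u ≡ φLength h u
φLength-cong zero    _  = refl
φLength-cong (suc u) eq =
  cong₂ (λ a n → length (φ a) + n) (eq 0 z<s) (φLength-cong u (λ t t< → eq (suc t) (s<s t<)))

φLength-≥ : ∀ g u → u ≤ φLength g u
φLength-≥ g zero    = z≤n
φLength-≥ g (suc u) = +-mono-≤ (1≤length-φ (g 0)) (φLength-≥ (λ t → g (suc t)) u)

nth-φ* : ∀ w {u o} → u < length w → o < length (φ (nth w u)) →
  nth (φ* w) (φLength (nth w) u + o) ≡ nth (φ (nth w u)) o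
nth-φ* (x ∷ w) {zero}  _        o< = nth-++ˡ (φ x) (φ* w) o<
nth-φ* (x ∷ w) {suc u} {o} (s≤s u<) o< = begin
  nth (φ x ++ φ* w) (length (φ x) + φLength (nth w) u + o)   ≡⟨ cong (nth (φ x ++ φ* w)) (+-assoc (length (φ x)) _ o) ⟩
  nth (φ x ++ φ* w) (length (φ x) + (φLength (nth w) u + o)) ≡⟨ nth-++ʳ (φ x) (φ* w) _ ⟩
  nth (φ* w) (φLength (nth w) u + o)                         ≡⟨ nth-φ* w u< o< ⟩
  nth (φ (nth w u)) o                                        ∎
  where open ≡-Reasoning

fibWord-φ : ∀ u {o} → o < length (φ (fibWord u)) → fibWord (φpos u + o) ≡ nth (φ (fibWord u)) o
fibWord-φ u {o} o< = begin
  fibWord (φpos u + o)                ≡⟨ fibWord-fibPrefix (suc n) (<-≤-trans (n<fibLen n) (fibLen-suc-≥ n)) ⟩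
  nth (fibPrefix (suc n)) (φpos u + o) ≡⟨ cong (λ w → nth w (φpos u + o)) (φ^-suc n (false ∷ [])) ⟩
  nth (φ* W) (φpos u + o)             ≡⟨ cong (λ k → nth (φ* W) (k + o)) (φLength-cong u agree) ⟩
  nth (φ* W) (φLength (nth W) u + o)  ≡⟨ nth-φ* W u<W (subst (λ a → o < length (φ a)) (f≡W u<F) o<) ⟩
  nth (φ (nth W u)) o                 ≡⟨ cong (λ a → nth (φ a) o) (f≡W u<F) ⟨
  nth (φ (fibWord u)) o               ∎
  where
  open ≡-Reasoning
  n = φpos u + o
  W = fibPrefix n
  f≡W : ∀ {t} → t < fibLen n → fibWord t ≡ nth W t
  f≡W = fibWord-fibPrefix n
  u<F : u < fibLen n
  u<F = ≤-<-trans (≤-trans (φLength-≥ fibWord u) (m≤m+n _ o)) (n<fibLen n)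
  u<W : u < length W
  u<W = subst (u <_) (sym (length-fibPrefix n)) u<F
  agree : ∀ t → t < u → fibWord t ≡ nth W t
  agree t t< = f≡W (<-trans t< u<F)

fibWord-φpos : ∀ u → fibWord (φpos u) ≡ false
fibWord-φpos u =
  trans (cong fibWord (sym (+-identityʳ (φpos u))))
    (trans (fibWord-φ u (1≤length-φ (fibWord u))) (head-φ (fibWord u)))
  where
  head-φ : ∀ a → nth (φ a) 0 ≡ false
  head-φ false = refl
  head-φ true  = refl

fibWord-φpos-suc : ∀ u → fibWord u ≡ false → fibWord (suc (φpos u)) ≡ true
fibWord-φpos-suc u f≡ =
  trans (cong fibWord (+-comm 1 (φpos u)))
    (trans (fibWord-φ u (subst (λ a → 1 < length (φ a)) (sym f≡) ≤-refl))
      (cong (λ a → nth (φ a) 1) f≡))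

-- Factors of f

data Occurs : List Bool → ℕ → Set where
  []  : ∀ {u} → Occurs [] u
  _∷_ : ∀ {x w u} → fibWord u ≡ x → Occurs w (suc u) → Occurs (x ∷ w) u

Occurs-++ : ∀ {a b u} → Occurs a u → Occurs b (u + length a) → Occurs (a ++ b) u
Occurs-++ {b = b} {u} []            ob = subst (Occurs b) (+-identityʳ u) ob
Occurs-++ {a = _ ∷ a} {b} {u} (e ∷ oa) ob = e ∷ Occurs-++ oa (subst (Occurs b) (+-suc u (length a)) ob)

Occurs-++⁻ : ∀ a {b u} → Occurs (a ++ b) u → Occurs a u × Occurs b (u + length a)
Occurs-++⁻ []      {b} {u} o       = [] , subst (Occurs b) (sym (+-identityʳ u)) o
Occurs-++⁻ (x ∷ a) {b} {u} (e ∷ o) =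
  let oa , ob = Occurs-++⁻ a o in (e ∷ oa) , subst (Occurs b) (sym (+-suc u (length a))) ob

Occurs-prefix : ∀ a {b u} → Occurs (a ++ b) u → Occurs a u
Occurs-prefix a o = proj₁ (Occurs-++⁻ a o)

Occurs-infix : ∀ pre {v rest u} → Occurs (pre ++ v ++ rest) u → Occurs v (u + length pre)
Occurs-infix pre {v} o = Occurs-prefix v (proj₂ (Occurs-++⁻ pre o))

Occurs⇒nth : ∀ {w u} → Occurs w u → ∀ {o} → o < length w → fibWord (u + o) ≡ nth w o
Occurs⇒nth {u = u} (e ∷ _)  {zero}  _        = trans (cong fibWord (+-identityʳ u)) e
Occurs⇒nth {u = u} (_ ∷ oc) {suc o} (s≤s o<) = trans (cong fibWord (+-suc u o)) (Occurs⇒nth oc o<)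

nth⇒Occurs : ∀ w {u} → (∀ {o} → o < length w → fibWord (u + o) ≡ nth w o) → Occurs w u
nth⇒Occurs []      _ = []
nth⇒Occurs (x ∷ w) {u} h =
  trans (cong fibWord (sym (+-identityʳ u))) (h z<s) ∷
  nth⇒Occurs w (λ {o} o< → trans (cong fibWord (sym (+-suc u o))) (h (s<s o<)))

Occurs-φ* : ∀ {w u} → Occurs w u → Occurs (φ* w) (φpos u)
Occurs-φ* []                    = []
Occurs-φ* {_ ∷ w} {u} (refl ∷ o) =
  Occurs-++ (nth⇒Occurs (φ (fibWord u)) (fibWord-φ u))
    (subst (Occurs (φ* w)) (φLength-suc fibWord u) (Occurs-φ* o))

φpos-+ : ∀ {w u} → Occurs w u → φpos (u + length w) ≡ φpos u + length (φ* w)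
φpos-+ {[]}    {u} []         = trans (cong φpos (+-identityʳ u)) (sym (+-identityʳ _))
φpos-+ {x ∷ w} {u} (refl ∷ o) = begin
  φpos (u + suc (length w))                            ≡⟨ cong φpos (+-suc u (length w)) ⟩
  φpos (suc u + length w)                              ≡⟨ φpos-+ o ⟩
  φpos (suc u) + length (φ* w)                         ≡⟨ cong (_+ length (φ* w)) (φLength-suc fibWord u) ⟩
  φpos u + length (φ (fibWord u)) + length (φ* w)      ≡⟨ +-assoc (φpos u) _ _ ⟩
  φpos u + (length (φ (fibWord u)) + length (φ* w))    ≡⟨ cong (φpos u +_) (length-++ (φ (fibWord u))) ⟨
  φpos u + length (φ (fibWord u) ++ φ* w)              ∎
  where open ≡-Reasoning

φ^pos : ℕ → ℕ → ℕ
φ^pos zero    u = u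
φ^pos (suc m) u = φ^pos m (φpos u)

Occurs-φ^ : ∀ m {w u} → Occurs w u → Occurs (φ^ m w) (φ^pos m u)
Occurs-φ^ zero    o = o
Occurs-φ^ (suc m) o = Occurs-φ^ m (Occurs-φ* o)

φ^pos-+ : ∀ m {w u} → Occurs w u → φ^pos m (u + length w) ≡ φ^pos m u + length (φ^ m w)
φ^pos-+ zero    _ = refl
φ^pos-+ (suc m) o = trans (cong (φ^pos m) (φpos-+ o)) (φ^pos-+ m (Occurs-φ* o))

φpos-preimage : ∀ x → Σ ℕ λ u → Σ ℕ λ d → (φpos u + d ≡ x) × (d < length (φ (fibWord u)))
φpos-preimage zero = 0 , 0 , refl , z<s
φpos-preimage (suc x) with φpos-preimage x
... | u , d , e , d< with m≤n⇒m<n∨m≡n d<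
...   | inj₁ sd< = u , suc d , trans (+-suc (φpos u) d) (cong suc e) , sd<
...   | inj₂ sd≡ = suc u , 0 , position , 1≤length-φ (fibWord (suc u))
  where
  open ≡-Reasoning
  position : φpos (suc u) + 0 ≡ suc x
  position = begin
    φpos (suc u) + 0                ≡⟨ +-identityʳ _ ⟩
    φpos (suc u)                    ≡⟨ φLength-suc fibWord u ⟩
    φpos u + length (φ (fibWord u)) ≡⟨ cong (φpos u +_) sd≡ ⟨
    φpos u + suc d                  ≡⟨ +-suc (φpos u) d ⟩
    suc (φpos u + d)                ≡⟨ cong suc e ⟩
    suc x                           ∎

-- f starts with 0, so every block after the first starts strictly to the right of its letter.
φpos-preimage-< : ∀ u {d x} → φpos u + d ≡ x → 1 ≤ x → u < x
φpos-preimage-< zero        _    1≤x = 1≤x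
φpos-preimage-< (suc u) {d} refl _   =
  ≤-trans (s≤s (s≤s (φLength-≥ (λ t → fibWord (suc t)) u))) (m≤m+n (φpos (suc u)) d)

data Window : Set where
  w0010 w0100 w0101 w1001 w1010 : Window

letters : Window → List Bool
letters w0010 = false ∷ false ∷ true ∷ false ∷ []
letters w0100 = false ∷ true ∷ false ∷ false ∷ []
letters w0101 = false ∷ true ∷ false ∷ true ∷ []
letters w1001 = true ∷ false ∷ false ∷ true ∷ []
letters w1010 = true ∷ false ∷ true ∷ false ∷ []

Occurs-head : ∀ s {u} → Occurs (letters s) u → fibWord u ≡ nth (letters s) 0
Occurs-head w0010 (e ∷ _) = e
Occurs-head w0100 (e ∷ _) = e
Occurs-head w0101 (e ∷ _) = e
Occurs-head w1001 (e ∷ _) = e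
Occurs-head w1010 (e ∷ _) = e

window-image : ∀ s {u d} → Occurs (letters s) u → d < length (φ (nth (letters s) 0)) →
  Σ Window λ s' → Occurs (letters s') (φpos u + d)
window-image w0010 {d = 0} o _ = w0101 , Occurs-infix [] {letters w0101} (Occurs-φ* o)
window-image w0010 {d = 1} o _ = w1010 , Occurs-infix (false ∷ []) {letters w1010} (Occurs-φ* o)
window-image w0010 {d = suc (suc _)} _ (s≤s (s≤s ()))
window-image w0100 {d = 0} o _ = w0100 , Occurs-infix [] {letters w0100} (Occurs-φ* o)
window-image w0100 {d = 1} o _ = w1001 , Occurs-infix (false ∷ []) {letters w1001} (Occurs-φ* o)
window-image w0100 {d = suc (suc _)} _ (s≤s (s≤s ()))
window-image w0101 {d = 0} o _ = w0100 , Occurs-infix [] {letters w0100} (Occurs-φ* o)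
window-image w0101 {d = 1} o _ = w1001 , Occurs-infix (false ∷ []) {letters w1001} (Occurs-φ* o)
window-image w0101 {d = suc (suc _)} _ (s≤s (s≤s ()))
window-image w1001 {d = 0} o _ = w0010 , Occurs-infix [] {letters w0010} (Occurs-φ* o)
window-image w1001 {d = suc _} _ (s≤s ())
window-image w1010 {d = 0} o _ = w0010 , Occurs-infix [] {letters w0010} (Occurs-φ* o)
window-image w1010 {d = suc _} _ (s≤s ())

window-at : ∀ x → Σ Window λ s → Occurs (letters s) x
window-at = <-rec (λ x → Σ Window λ s → Occurs (letters s) x) step
  where
  step : ∀ x → (∀ {y} → y < x → Σ Window λ s → Occurs (letters s) y) → Σ Window λ s → Occurs (letters s) x
  step zero    _  = w0100 , refl ∷ refl ∷ refl ∷ refl ∷ []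
  step (suc x) ih with φpos-preimage (suc x)
  ... | u , d , e , d< with ih (φpos-preimage-< u e (s≤s z≤n))
  ... | s , o with window-image s o (subst (λ a → d < length (φ a)) (Occurs-head s o) d<)
  ... | s' , o' = s' , subst (Occurs (letters s')) e o'

-- The windows that end at the letters of φ(last letter of s), merged into one factor of φ(s)
childLetters : Window → List Bool
childLetters w0010 = letters w0100 ++ true ∷ []
childLetters w0100 = letters w0010 ++ true ∷ []
childLetters w0101 = letters w0010
childLetters w1001 = letters w1010
childLetters w1010 = letters w0100 ++ true ∷ []

image-window : ∀ t₃ a pre v rest {b} → Occurs (t₃ ++ a ∷ []) b →
  φ* (t₃ ++ a ∷ []) ≡ pre ++ v ++ rest → length (φ* t₃) ≡ length pre + length t₃ →
  Σ ℕ λ b' → (b' + length t₃ ≡ φpos (b + length t₃)) × Occurs v b'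
image-window t₃ a pre v rest {b} occ eq len =
  φpos b + length pre , position ,
  Occurs-infix pre {v} {rest} (subst (λ w → Occurs w (φpos b)) eq (Occurs-φ* occ))
  where
  position : φpos b + length pre + length t₃ ≡ φpos (b + length t₃)
  position = trans (+-assoc (φpos b) (length pre) (length t₃))
    (trans (cong (φpos b +_) (sym len)) (sym (φpos-+ (Occurs-prefix t₃ occ))))

child : ∀ s {b} → Occurs (letters s) b → Σ ℕ λ b' → (b' + 3 ≡ φpos (b + 3)) × Occurs (childLetters s) b'
child w0010 o =
  image-window (false ∷ false ∷ true ∷ []) false (false ∷ true ∷ []) (childLetters w0010) [] o refl refl
child w0100 o =
  image-window (false ∷ true ∷ false ∷ []) false (false ∷ true ∷ []) (childLetters w0100) [] o refl refl
child w0101 o =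
  image-window (false ∷ true ∷ false ∷ []) true (false ∷ true ∷ []) (childLetters w0101) [] o refl refl
child w1001 o =
  image-window (true ∷ false ∷ false ∷ []) true (false ∷ false ∷ []) (childLetters w1001) [] o refl refl
child w1010 o =
  image-window (true ∷ false ∷ true ∷ []) false (false ∷ []) (childLetters w1010) [] o refl refl

-- Cubes

PeriodicRun : ℕ → ℕ → ℕ → Set
PeriodicRun u p r = ∀ i → i < r → fibWord (u + i) ≡ fibWord (u + (p + i))

PeriodicRun-shift : ∀ {u p r} t {r'} → t + r' ≤ r → PeriodicRun u p r → PeriodicRun (u + t) p r'
PeriodicRun-shift {u} {p} t t+r'≤r run i i< = begin
  fibWord (u + t + i)         ≡⟨ cong fibWord (+-assoc u t i) ⟩
  fibWord (u + (t + i))       ≡⟨ run (t + i) (<-≤-trans (+-monoʳ-< t i<) t+r'≤r) ⟩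
  fibWord (u + (p + (t + i))) ≡⟨ cong fibWord (shuffle u t p i) ⟩
  fibWord (u + t + (p + i))   ∎
  where
  open ≡-Reasoning
  shuffle : ∀ u t p i → u + (p + (t + i)) ≡ u + t + (p + i)
  shuffle = solve-∀

PeriodicRun⇒CubeEndsAt : ∀ {i p} → 1 ≤ p → PeriodicRun i p (p + p) → CubeEndsAt (i + 3 * p ∸ 1)
PeriodicRun⇒CubeEndsAt {i} {p} 1≤p run =
  i , p , 1≤p , m∸n+n≡m 1≤end , x , length-applyUpTo g p , cube
  where
  open ≡-Reasoning
  g : ℕ → Bool
  g t = fibWord (i + t)
  x = applyUpTo g p
  1≤end : 1 ≤ i + 3 * p
  1≤end = ≤-trans 1≤p (≤-trans (m≤m+n p _) (m≤n+m (3 * p) i))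
  shifted : ∀ t → t < p + p → g (p + t) ≡ g t
  shifted t t< = sym (run t t<)
  cube : factor i (3 * p) ≡ x ++ x ++ x
  cube = begin
    factor i (3 * p)                            ≡⟨ map-upTo g (3 * p) ⟩
    applyUpTo g (p + (p + (p + 0)))             ≡⟨ cong (λ n → applyUpTo g (p + (p + n))) (+-identityʳ p) ⟩
    applyUpTo g (p + (p + p))                   ≡⟨ applyUpTo-+ g p (p + p) ⟩
    x ++ applyUpTo (λ t → g (p + t)) (p + p)    ≡⟨ cong (x ++_) (applyUpTo-cong (p + p) shifted) ⟩
    x ++ applyUpTo g (p + p)                    ≡⟨ cong (x ++_) (applyUpTo-+ g p p) ⟩
    x ++ x ++ applyUpTo (λ t → g (p + t)) p     ≡⟨ cong (λ y → x ++ x ++ y)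
                                                     (applyUpTo-cong p (λ t t< → shifted t (≤-trans t< (m≤m+n p p)))) ⟩
    x ++ x ++ x                                 ∎

Occurs⇒PeriodicRun : ∀ {w u p r} → Occurs w u → p + r ≤ length w →
  (∀ i → i < r → nth w i ≡ nth w (p + i)) → PeriodicRun u p r
Occurs⇒PeriodicRun {p = p} {r} occ fits per i i< =
  trans (Occurs⇒nth occ (<-≤-trans i< (≤-trans (m≤n+m r p) fits)))
    (trans (per i i<) (sym (Occurs⇒nth occ (<-≤-trans (+-monoʳ-< p i<) fits))))

AABA-periodic : ∀ (A B q : List Bool) a b → A ++ B ≡ q ++ a ∷ b ∷ [] → B ++ A ≡ q ++ b ∷ a ∷ [] →
  ∀ i → i < length A + length q → nth (A ++ A ++ B ++ A) i ≡ nth (A ++ A ++ B ++ A) (length A + i)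
AABA-periodic A B q a b AB BA i i< with i <? length A
... | yes i<A = begin
  nth (A ++ A ++ B ++ A) i                ≡⟨ nth-++ˡ A _ i<A ⟩
  nth A i                                 ≡⟨ nth-++ˡ A _ i<A ⟨
  nth (A ++ B ++ A) i                     ≡⟨ nth-++ʳ A _ i ⟨
  nth (A ++ A ++ B ++ A) (length A + i)   ∎
  where open ≡-Reasoning
... | no i≮A = subst (λ k → nth R k ≡ nth R (length A + k)) (m+[n∸m]≡n A≤i) (shifted j<q)
  where
  open ≡-Reasoning
  R = A ++ A ++ B ++ A
  A≤i = ≮⇒≥ i≮A
  j<q : i ∸ length A < length q
  j<q = +-cancelˡ-< (length A) _ _ (subst (_< length A + length q) (sym (m+[n∸m]≡n A≤i)) i<)
  ABA : A ++ B ++ A ≡ q ++ a ∷ b ∷ A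
  ABA = trans (sym (++-assoc A B A)) (trans (cong (_++ A) AB) (++-assoc q (a ∷ b ∷ []) A))
  shifted : ∀ {j} → j < length q → nth R (length A + j) ≡ nth R (length A + (length A + j))
  shifted {j} j< = begin
    nth R (length A + j)                  ≡⟨ nth-++ʳ A _ j ⟩
    nth (A ++ B ++ A) j                   ≡⟨ nth-prefix q (a ∷ b ∷ A) ABA j< ⟩
    nth q j                               ≡⟨ nth-prefix q (b ∷ a ∷ []) BA j< ⟨
    nth (B ++ A) j                        ≡⟨ nth-++ʳ A _ j ⟨
    nth (A ++ B ++ A) (length A + j)      ≡⟨ nth-++ʳ A _ (length A + j) ⟨
    nth R (length A + (length A + j))     ∎

φ^-0010 : ∀ m → φ^ (suc m) (letters w0010) ≡
  fibPrefix (suc m) ++ fibPrefix (suc m) ++ fibPrefix m ++ fibPrefix (suc m)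
φ^-0010 m =
  trans (φ^-++ (suc m) (false ∷ []) (false ∷ true ∷ false ∷ [])) (cong (fibPrefix (suc m) ++_)
    (trans (φ^-++ (suc m) (false ∷ []) (true ∷ false ∷ [])) (cong (fibPrefix (suc m) ++_)
      (φ^-++ (suc m) (true ∷ []) (false ∷ [])))))

PeriodicRun-φ^0010 : ∀ m {b} → Occurs (letters w0010) b →
  PeriodicRun (φ^pos (suc m) b) (fibLen (suc m)) (fibLen (suc m) + fibLen (suc m) + fibLen m ∸ 2)
PeriodicRun-φ^0010 m {b} occ with fibPrefix-swap m
... | q , a , a' , AB , BA =
  subst₂ (PeriodicRun (φ^pos (suc m) b)) (length-fibPrefix (suc m)) run-length
    (Occurs⇒PeriodicRun occR fits (AABA-periodic A B q a a' AB BA))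
  where
  open ≡-Reasoning
  A = fibPrefix (suc m)
  B = fibPrefix m
  occR : Occurs (A ++ A ++ B ++ A) (φ^pos (suc m) b)
  occR = subst (λ w → Occurs w (φ^pos (suc m) b)) (φ^-0010 m) (Occurs-φ^ (suc m) occ)
  |q|+2 : length q + 2 ≡ length A + length B
  |q|+2 = trans (sym (length-++ q)) (trans (cong length (sym AB)) (length-++ A))
  fits : length A + (length A + length q) ≤ length (A ++ A ++ B ++ A)
  fits = ≤-trans (+-monoʳ-≤ (length A) (+-monoʳ-≤ (length A) q≤))
    (≤-reflexive (sym (trans (length-++ A) (cong (length A +_) (length-++ A)))))
    where
    q≤ : length q ≤ length (B ++ A)
    q≤ = ≤-trans (m≤m+n (length q) 2)
      (≤-reflexive (trans |q|+2 (trans (+-comm (length A) (length B)) (sym (length-++ B)))))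
  run-length : length A + length q ≡ fibLen (suc m) + fibLen (suc m) + fibLen m ∸ 2
  run-length = sym (begin
    fibLen (suc m) + fibLen (suc m) + fibLen m ∸ 2 ≡⟨ cong (_∸ 2) (+-assoc (fibLen (suc m)) _ _) ⟩
    fibLen (suc m) + (fibLen (suc m) + fibLen m) ∸ 2
      ≡⟨ cong₂ (λ x y → x + (x + y) ∸ 2) (length-fibPrefix (suc m)) (length-fibPrefix m) ⟨
    length A + (length A + length B) ∸ 2  ≡⟨ cong (λ x → length A + x ∸ 2) |q|+2 ⟨
    length A + (length q + 2) ∸ 2         ≡⟨ cong (_∸ 2) (+-assoc (length A) _ 2) ⟨
    length A + length q + 2 ∸ 2           ≡⟨ m+n∸n≡m _ 2 ⟩
    length A + length q                   ∎)

CubeEndsAt-0010-image : ∀ n {b} → Occurs (letters w0010) b → ∀ t → t + 2 < fibLen (suc n) →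
  CubeEndsAt (φ^pos (2 + n) (b + 3) + fibLen n + t)
CubeEndsAt-0010-image n {b} occ t t+2< =
  subst CubeEndsAt position
    (PeriodicRun⇒CubeEndsAt {B₀ + suc t} {L} (fibLen-pos (2 + n))
      (PeriodicRun-shift {B₀} {L} (suc t) fits (PeriodicRun-φ^0010 (suc n) occ)))
  where
  B₀ = φ^pos (2 + n) b
  L  = fibLen (2 + n)
  F  = fibLen (suc n)
  fits : suc t + (L + L) ≤ L + L + F ∸ 2
  fits = m+n≤o⇒m≤o∸n (suc t + (L + L))
    (≤-trans (≤-reflexive (regroup t L)) (+-monoʳ-≤ (L + L) t+2<))
    where
    regroup : ∀ t L → suc t + (L + L) + 2 ≡ L + L + suc (t + 2)
    regroup = solve-∀
  image-start : φ^pos (2 + n) (b + 3) ≡ B₀ + (L + (L + F))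
  image-start =
    trans (φ^pos-+ (2 + n) {false ∷ false ∷ true ∷ []} (Occurs-prefix (false ∷ false ∷ true ∷ []) occ))
      (cong (B₀ +_) (trans (length-φ^-∷ (2 + n) false (false ∷ true ∷ []))
        (cong₂ _+_ (length-fibPrefix (2 + n))
          (trans (length-φ^-∷ (2 + n) false (true ∷ []))
            (cong₂ _+_ (length-fibPrefix (2 + n)) (length-fibPrefix (suc n)))))))
  cube-end : ∀ B t F G → B + suc t + 3 * (F + G) ≡ suc (B + ((F + G) + ((F + G) + F)) + G + t)
  cube-end = solve-∀
  position : B₀ + suc t + 3 * L ∸ 1 ≡ φ^pos (2 + n) (b + 3) + fibLen n + t
  position = trans (cong (_∸ 1) (cube-end B₀ t F (fibLen n)))
    (cong (λ x → x + fibLen n + t) (sym image-start))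

-- Counting zeros

zerosIn : (ℕ → Bool) → ℕ → ℕ → ℕ
zerosIn c a zero    = 0
zerosIn c a (suc n) = zerosIn c a n + (if c (a + n) then 0 else 1)

zerosBelow≡zerosIn : ∀ c N → zerosBelow c N ≡ zerosIn c 0 N
zerosBelow≡zerosIn c zero    = refl
zerosBelow≡zerosIn c (suc N) = cong (_+ (if c N then 0 else 1)) (zerosBelow≡zerosIn c N)

zerosIn-+ : ∀ c a m n → zerosIn c a (m + n) ≡ zerosIn c a m + zerosIn c (a + m) n
zerosIn-+ c a m zero    = trans (cong (zerosIn c a) (+-identityʳ m)) (sym (+-identityʳ _))
zerosIn-+ c a m (suc n) = begin
  zerosIn c a (m + suc n)                               ≡⟨ cong (zerosIn c a) (+-suc m n) ⟩
  zerosIn c a (m + n) + z (a + (m + n))                 ≡⟨ cong₂ _+_ (zerosIn-+ c a m n) (cong z (sym (+-assoc a m n))) ⟩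
  zerosIn c a m + zerosIn c (a + m) n + z (a + m + n)   ≡⟨ +-assoc (zerosIn c a m) _ _ ⟩
  zerosIn c a m + zerosIn c (a + m) (suc n)             ∎
  where
  open ≡-Reasoning
  z : ℕ → ℕ
  z i = if c i then 0 else 1

zerosIn-≤ : ∀ c a n → zerosIn c a n ≤ n
zerosIn-≤ c a zero    = z≤n
zerosIn-≤ c a (suc n) =
  ≤-trans (+-mono-≤ (zerosIn-≤ c a n) (indicator≤1 (c (a + n)))) (≤-reflexive (+-comm n 1))
  where
  indicator≤1 : ∀ b → (if b then 0 else 1) ≤ 1
  indicator≤1 true  = z≤n
  indicator≤1 false = ≤-refl

zerosIn-mono : ∀ c a {m n} → m ≤ n → zerosIn c a m ≤ zerosIn c a n
zerosIn-mono c a {m} {n} m≤n =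
  subst (λ k → zerosIn c a m ≤ zerosIn c a k) (m+[n∸m]≡n m≤n)
    (≤-trans (m≤m+n _ _) (≤-reflexive (sym (zerosIn-+ c a m (n ∸ m)))))

zerosIn-allTrue : ∀ c a n → (∀ t → t < n → c (a + t) ≡ true) → zerosIn c a n ≡ 0
zerosIn-allTrue c a zero    _ = refl
zerosIn-allTrue c a (suc n) h
  rewrite zerosIn-allTrue c a n (λ t t< → h t (m<n⇒m<1+n t<)) | h n ≤-refl = refl

zerosIn-≤-trailing : ∀ c a n r → (∀ t → t + r < n → c (a + t) ≡ true) → zerosIn c a n ≤ r
zerosIn-≤-trailing c a n r covered with r ≤? n
... | no r≰n = ≤-trans (zerosIn-≤ c a n) (<⇒≤ (≰⇒> r≰n))
... | yes r≤n = begin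
  zerosIn c a n                                   ≡⟨ cong (zerosIn c a) (m∸n+n≡m r≤n) ⟨
  zerosIn c a (n ∸ r + r)                         ≡⟨ zerosIn-+ c a (n ∸ r) r ⟩
  zerosIn c a (n ∸ r) + zerosIn c (a + (n ∸ r)) r ≡⟨ cong (_+ zerosIn c _ r) (zerosIn-allTrue c a (n ∸ r) head) ⟩
  zerosIn c (a + (n ∸ r)) r                       ≤⟨ zerosIn-≤ c _ r ⟩
  r                                               ∎
  where
  open ≤-Reasoning
  head : ∀ t → t < n ∸ r → c (a + t) ≡ true
  head t t< = covered t (subst (t + r <_) (m∸n+n≡m r≤n) (+-monoˡ-< r t<))

blockLength : ℕ → ℕ → ℕ
blockLength m v = length (φ^ m (fibWord v ∷ []))

blockLength-false : ∀ m v → fibWord v ≡ false → blockLength m v ≡ fibLen m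
blockLength-false m v f≡ = trans (cong (λ a → length (φ^ m (a ∷ []))) f≡) (length-fibPrefix m)

-- Bounds the zeros in the depth-m block of the last letter of s; they are stable under
-- passing to the children of s, the linear one for 0010 only thanks to the cubes.
bound : ℕ → Window → ℕ
bound m w0010 = suc m
bound m w0100 = suc (m + m)
bound m w0101 = suc m
bound m w1001 = suc m * suc m
bound m w1010 = suc m * suc m

1≤bound : ∀ m s → 1 ≤ bound m s
1≤bound m w0010 = s≤s z≤n
1≤bound m w0100 = s≤s z≤n
1≤bound m w0101 = s≤s z≤n
1≤bound m w1001 = s≤s z≤n
1≤bound m w1010 = s≤s z≤n

bound≤square : ∀ m s → bound m s ≤ suc m * suc m
bound≤square m w0010 = m≤m*n (suc m) (suc m)
bound≤square m w0100 = s≤s (+-monoʳ-≤ m (m≤m*n m (suc m)))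
bound≤square m w0101 = m≤m*n (suc m) (suc m)
bound≤square m w1001 = ≤-refl
bound≤square m w1010 = ≤-refl

module BlockZeros (c : ℕ → Bool) (cube⇒1 : ∀ j → CubeEndsAt j → c j ≡ true) where

  blockZeros : ℕ → ℕ → ℕ
  blockZeros m v = zerosIn c (φ^pos m v) (blockLength m v)

  blockZeros-suc-true : ∀ m v {w} → fibWord v ≡ true → w ≡ φpos v → blockZeros (suc m) v ≡ blockZeros m w
  blockZeros-suc-true m v f≡ refl =
    cong (zerosIn c (φ^pos m (φpos v)))
      (trans (cong (λ a → length (φ^ (suc m) (a ∷ []))) f≡)
        (trans (length-fibPrefix m) (sym (blockLength-false m (φpos v) (fibWord-φpos v)))))

  blockZeros-suc-false : ∀ m v {w} → fibWord v ≡ false → w ≡ φpos v →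
    blockZeros (suc m) v ≡ blockZeros m w + blockZeros m (suc w)
  blockZeros-suc-false m v f≡ refl = begin
    zerosIn c P (blockLength (suc m) v)                 ≡⟨ cong (zerosIn c P) split ⟩
    zerosIn c P (blockLength m w + blockLength m (suc w)) ≡⟨ zerosIn-+ c P (blockLength m w) _ ⟩
    blockZeros m w + zerosIn c (P + blockLength m w) (blockLength m (suc w))
      ≡⟨ cong (λ x → blockZeros m w + zerosIn c x (blockLength m (suc w))) next ⟨
    blockZeros m w + blockZeros m (suc w)               ∎
    where
    open ≡-Reasoning
    w = φpos v
    P = φ^pos m w
    split : blockLength (suc m) v ≡ blockLength m w + blockLength m (suc w)
    split = trans (cong (λ a → length (φ^ (suc m) (a ∷ []))) f≡)
      (trans (length-φ^-∷ m false (true ∷ []))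
        (cong₂ (λ a a' → length (φ^ m (a ∷ [])) + length (φ^ m (a' ∷ [])))
          (sym (fibWord-φpos v)) (sym (fibWord-φpos-suc v f≡))))
    next : φ^pos m (suc w) ≡ P + blockLength m w
    next = trans (cong (φ^pos m) (+-comm 1 w)) (φ^pos-+ m {fibWord w ∷ []} {w} (refl ∷ []))

  blockZeros-0010 : ∀ n {b} → Occurs (letters w0010) b →
    blockZeros (2 + n) (b + 3) ≤ blockZeros n (φpos (φpos (b + 3))) + 2
  blockZeros-0010 n {b} occ = begin
    zerosIn c P (blockLength (2 + n) (b + 3))   ≡⟨ cong (zerosIn c P) lengths ⟩
    zerosIn c P (fibLen n + fibLen (suc n))     ≡⟨ zerosIn-+ c P (fibLen n) (fibLen (suc n)) ⟩
    zerosIn c P (fibLen n) + zerosIn c (P + fibLen n) (fibLen (suc n))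
      ≤⟨ +-mono-≤ (≤-reflexive head) (zerosIn-≤-trailing c _ _ 2 covered) ⟩
    blockZeros n (φpos (φpos (b + 3))) + 2      ∎
    where
    open ≤-Reasoning
    P = φ^pos (2 + n) (b + 3)
    lengths : blockLength (2 + n) (b + 3) ≡ fibLen n + fibLen (suc n)
    lengths = trans (blockLength-false (2 + n) (b + 3) (Occurs⇒nth occ {3} ≤-refl)) (+-comm (fibLen (suc n)) _)
    head : zerosIn c P (fibLen n) ≡ blockZeros n (φpos (φpos (b + 3)))
    head = cong (zerosIn c P) (sym (blockLength-false n (φpos v₁) (fibWord-φpos v₁)))
      where v₁ = φpos (b + 3)
    covered : ∀ t → t + 2 < fibLen (suc n) → c (P + fibLen n + t) ≡ true
    covered t t+2< = cube⇒1 _ (CubeEndsAt-0010-image n occ t t+2<)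

  blockZeros-bound : ∀ m s {b} → Occurs (letters s) b → blockZeros m (b + 3) ≤ bound m s
  blockZeros-bound zero s _ = ≤-trans (zerosIn-≤ c _ 1) (1≤bound 0 s)
  blockZeros-bound (suc zero) w0010 {b} occ =
    ≤-trans (zerosIn-≤ c _ _) (≤-reflexive (blockLength-false 1 (b + 3) (Occurs⇒nth occ {3} ≤-refl)))
  blockZeros-bound (suc (suc n)) w0010 {b} occ =
    let b₁ , e₁ , occ₁ = child w0010 occ
        b₂ , e₂ , occ₂ = child w0100 (Occurs-prefix (letters w0100) occ₁)
    in begin
      blockZeros (2 + n) (b + 3)             ≤⟨ blockZeros-0010 n occ ⟩
      blockZeros n (φpos (φpos (b + 3))) + 2 ≡⟨ cong (λ v → blockZeros n v + 2) (trans (cong φpos (sym e₁)) (sym e₂)) ⟩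
      blockZeros n (b₂ + 3) + 2              ≤⟨ +-monoˡ-≤ 2 (blockZeros-bound n w0010 (Occurs-prefix (letters w0010) occ₂)) ⟩
      suc n + 2                              ≡⟨ +-comm (suc n) 2 ⟩
      bound (2 + n) w0010                    ∎
    where open ≤-Reasoning
  blockZeros-bound (suc m) w0100 {b} occ with child w0100 occ
  ... | b' , e , occ'@(_ ∷ occ₂) = begin
    blockZeros (suc m) (b + 3)                         ≡⟨ blockZeros-suc-false m (b + 3) (Occurs⇒nth occ {3} ≤-refl) e ⟩
    blockZeros m (b' + 3) + blockZeros m (suc b' + 3)  ≤⟨ +-mono-≤ (blockZeros-bound m w0010 (Occurs-prefix (letters w0010) occ'))
                                                                   (blockZeros-bound m w0101 occ₂) ⟩
    suc m + suc m                                      ≤⟨ n≤1+n _ ⟩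
    bound (suc m) w0100                                ∎
    where open ≤-Reasoning
  blockZeros-bound (suc m) w0101 {b} occ with child w0101 occ
  ... | b' , e , occ' = begin
    blockZeros (suc m) (b + 3) ≡⟨ blockZeros-suc-true m (b + 3) (Occurs⇒nth occ {3} ≤-refl) e ⟩
    blockZeros m (b' + 3)      ≤⟨ blockZeros-bound m w0010 occ' ⟩
    suc m                      ≤⟨ n≤1+n _ ⟩
    bound (suc m) w0101        ∎
    where open ≤-Reasoning
  blockZeros-bound (suc m) w1001 {b} occ with child w1001 occ
  ... | b' , e , occ' = begin
    blockZeros (suc m) (b + 3) ≡⟨ blockZeros-suc-true m (b + 3) (Occurs⇒nth occ {3} ≤-refl) e ⟩
    blockZeros m (b' + 3)      ≤⟨ blockZeros-bound m w1010 occ' ⟩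
    suc m * suc m              ≤⟨ *-mono-≤ (n≤1+n (suc m)) (n≤1+n (suc m)) ⟩
    bound (suc m) w1001        ∎
    where open ≤-Reasoning
  blockZeros-bound (suc m) w1010 {b} occ with child w1010 occ
  ... | b' , e , occ'@(_ ∷ occ₂) = begin
    blockZeros (suc m) (b + 3)                         ≡⟨ blockZeros-suc-false m (b + 3) (Occurs⇒nth occ {3} ≤-refl) e ⟩
    blockZeros m (b' + 3) + blockZeros m (suc b' + 3)  ≤⟨ +-mono-≤ (blockZeros-bound m w0100 (Occurs-prefix (letters w0100) occ'))
                                                                   (blockZeros-bound m w1001 occ₂) ⟩
    suc (m + m) + suc m * suc m                        ≤⟨ m≤m+n _ 2 ⟩
    suc (m + m) + suc m * suc m + 2                    ≡⟨ square-step m ⟩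
    bound (suc m) w1010                                ∎
    where
    open ≤-Reasoning
    square-step : ∀ m → suc (m + m) + suc m * suc m + 2 ≡ suc (suc m) * suc (suc m)
    square-step = solve-∀

  blockZeros≤square : ∀ m n → blockZeros m (n + 3) ≤ suc m * suc m
  blockZeros≤square m n =
    let s , occ = window-at n in ≤-trans (blockZeros-bound m s occ) (bound≤square m s)

-- Growth

fibLen-+4 : ∀ n → 6 * fibLen n ≤ fibLen (4 + n)
fibLen-+4 zero          = toWitness {a? = 6 * fibLen 0 ≤? fibLen 4} _
fibLen-+4 (suc zero)    = toWitness {a? = 6 * fibLen 1 ≤? fibLen 5} _
fibLen-+4 (suc (suc n)) =
  ≤-trans (≤-reflexive (*-distribˡ-+ 6 (fibLen (suc n)) (fibLen n)))
    (+-mono-≤ (fibLen-+4 (suc n)) (fibLen-+4 n))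

squares-negligible : ∀ d → Σ ℕ λ M → (d + 2) * ((4 + M) * (4 + M)) ≤ fibLen (2 + M)
squares-negligible zero    = 12 , toWitness {a? = 2 * (16 * 16) ≤? fibLen 14} _
squares-negligible (suc d) with squares-negligible d
... | M , h = 4 + M , (begin
  (suc d + 2) * ((8 + M) * (8 + M))     ≤⟨ *-monoʳ-≤ (suc d + 2) square-+4 ⟩
  (suc d + 2) * (4 * s)                 ≤⟨ m≤m+n _ ((d + d) * s) ⟩
  (suc d + 2) * (4 * s) + (d + d) * s   ≡⟨ regroup d s ⟩
  6 * ((d + 2) * s)                     ≤⟨ *-monoʳ-≤ 6 h ⟩
  6 * fibLen (2 + M)                    ≤⟨ fibLen-+4 (2 + M) ⟩
  fibLen (6 + M)                        ∎)
  where
  open ≤-Reasoning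
  s = (4 + M) * (4 + M)
  square-+4 : (8 + M) * (8 + M) ≤ 4 * s
  square-+4 = ≤-trans (*-mono-≤ le le) (≤-reflexive (expand M))
    where
    le : 8 + M ≤ 8 + (M + M)
    le = +-monoʳ-≤ 8 (m≤m+n M M)
    expand : ∀ M → (8 + (M + M)) * (8 + (M + M)) ≡ 4 * ((4 + M) * (4 + M))
    expand = solve-∀
  regroup : ∀ d s → (suc d + 2) * (4 * s) + (d + d) * s ≡ 6 * ((d + 2) * s)
  regroup = solve-∀

module Density (c : ℕ → Bool) (d Lmax : ℕ) (T len : ℕ → ℕ)
  (T-suc : ∀ n → T (suc n) ≡ T n + len n) (1≤len : ∀ n → 1 ≤ len n) (len≤Lmax : ∀ n → len n ≤ Lmax)
  (sparse : ∀ n → d * zerosIn c (T n) (len n) ≤ len n) where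

  open ≤-Reasoning

  d*zerosIn-T : ∀ n → d * zerosIn c 0 (T n) ≤ d * T 0 + T n
  d*zerosIn-T zero    = ≤-trans (*-monoʳ-≤ d (zerosIn-≤ c 0 (T 0))) (m≤m+n _ _)
  d*zerosIn-T (suc n) = begin
    d * zerosIn c 0 (T (suc n))                              ≡⟨ cong (λ x → d * zerosIn c 0 x) (T-suc n) ⟩
    d * zerosIn c 0 (T n + len n)                            ≡⟨ cong (d *_) (zerosIn-+ c 0 (T n) (len n)) ⟩
    d * (zerosIn c 0 (T n) + zerosIn c (T n) (len n))        ≡⟨ *-distribˡ-+ d (zerosIn c 0 (T n)) _ ⟩
    d * zerosIn c 0 (T n) + d * zerosIn c (T n) (len n)      ≤⟨ +-mono-≤ (d*zerosIn-T n) (sparse n) ⟩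
    d * T 0 + T n + len n                                    ≡⟨ +-assoc (d * T 0) (T n) (len n) ⟩
    d * T 0 + (T n + len n)                                  ≡⟨ cong (d * T 0 +_) (T-suc n) ⟨
    d * T 0 + T (suc n)                                      ∎

  T-< : ∀ n → T n < T (suc n)
  T-< n = subst (T n <_) (sym (T-suc n))
    (≤-trans (≤-reflexive (+-comm 1 (T n))) (+-monoʳ-≤ (T n) (1≤len n)))

  n≤T : ∀ n → n ≤ T n
  n≤T zero    = z≤n
  n≤T (suc n) = ≤-<-trans (n≤T n) (T-< n)

  bracket : ∀ k {N} → T 0 ≤ N → N < T k → Σ ℕ λ n → T n ≤ N × N < T (suc n)
  bracket zero    T0≤N N<T0 = ⊥-elim (<⇒≱ N<T0 T0≤N)
  bracket (suc k) {N} T0≤N N<T with T k ≤? N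
  ... | yes Tk≤N = k , Tk≤N , N<T
  ... | no  Tk≰N = bracket k T0≤N (≰⇒> Tk≰N)

  d*zerosBelow≤ : ∀ N → T 0 ≤ N → d * zerosBelow c N ≤ d * T 0 + N + Lmax
  d*zerosBelow≤ N T0≤N with bracket (suc N) T0≤N (n≤T (suc N))
  ... | n , Tn≤N , N<T = begin
    d * zerosBelow c N            ≡⟨ cong (d *_) (zerosBelow≡zerosIn c N) ⟩
    d * zerosIn c 0 N             ≤⟨ *-monoʳ-≤ d (zerosIn-mono c 0 (<⇒≤ N<T)) ⟩
    d * zerosIn c 0 (T (suc n))   ≤⟨ d*zerosIn-T (suc n) ⟩
    d * T 0 + T (suc n)           ≡⟨ cong (d * T 0 +_) (T-suc n) ⟩
    d * T 0 + (T n + len n)       ≡⟨ +-assoc (d * T 0) (T n) (len n) ⟨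
    d * T 0 + T n + len n         ≤⟨ +-mono-≤ (+-monoʳ-≤ (d * T 0) Tn≤N) (len≤Lmax n) ⟩
    d * T 0 + N + Lmax            ∎

module _ (c : ℕ → Bool) (cube⇒1 : ∀ j → CubeEndsAt j → c j ≡ true) where

  open BlockZeros c cube⇒1

  zerosBelow-sparse : ∀ d → Σ ℕ λ N₁ → Σ ℕ λ C → ∀ N → N₁ ≤ N → d * zerosBelow c N ≤ N + C
  zerosBelow-sparse d =
    T 0 , d * T 0 + Lmax ,
    λ N T0≤N → ≤-trans (d*zerosBelow≤ N T0≤N) (≤-reflexive (rearrange (d * T 0) N Lmax))
    where
    M = proj₁ (squares-negligible d)
    S = 3 + M
    Lmax = fibLen S
    T len : ℕ → ℕ
    T n = φ^pos S (n + 3)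
    len n = blockLength S (n + 3)
    T-suc : ∀ n → T (suc n) ≡ T n + len n
    T-suc n = trans (cong (φ^pos S) (+-comm 1 (n + 3))) (φ^pos-+ S {fibWord (n + 3) ∷ []} {n + 3} (refl ∷ []))
    len-bounds : ∀ n → fibLen (2 + M) ≤ len n × len n ≤ Lmax
    len-bounds n = length-φ^-letter (2 + M) (fibWord (n + 3))
    sparse : ∀ n → d * zerosIn c (T n) (len n) ≤ len n
    sparse n = begin
      d * blockZeros S (n + 3)          ≤⟨ *-monoʳ-≤ d (blockZeros≤square S n) ⟩
      d * ((4 + M) * (4 + M))           ≤⟨ *-monoˡ-≤ ((4 + M) * (4 + M)) (m≤m+n d 2) ⟩
      (d + 2) * ((4 + M) * (4 + M))     ≤⟨ proj₂ (squares-negligible d) ⟩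
      fibLen (2 + M)                    ≤⟨ proj₁ (len-bounds n) ⟩
      len n                             ∎
      where open ≤-Reasoning
    open Density c d Lmax T len T-suc
      (λ n → ≤-trans (fibLen-pos (2 + M)) (proj₁ (len-bounds n))) (λ n → proj₂ (len-bounds n)) sparse
    rearrange : ∀ a N L → a + N + L ≡ N + (a + L)
    rearrange = solve-∀

theorem4 : (c : ℕ → Bool) → (∀ n → (c n ≡ true) ⇔ CubeEndsAt n) →
    (k : ℕ) → Σ ℕ λ N₀ → (N : ℕ) → N₀ ≤ N → k * zerosBelow c N < N
theorem4 c c⇔cube k = suc (N₁ + C) , density
  where
  sparse = zerosBelow-sparse c (λ j → Equivalence.from (c⇔cube j)) (2 * k)
  N₁ = proj₁ sparse
  C  = proj₁ (proj₂ sparse)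
  density : ∀ N → suc (N₁ + C) ≤ N → k * zerosBelow c N < N
  density N N₀≤N = *-cancelˡ-< 2 _ _ (begin-strict
    2 * (k * zerosBelow c N)  ≡⟨ *-assoc 2 k _ ⟨
    2 * k * zerosBelow c N    ≤⟨ proj₂ (proj₂ sparse) N (≤-trans (m≤m+n N₁ C) (<⇒≤ N₀≤N)) ⟩
    N + C                     <⟨ +-monoʳ-< N (≤-trans (s≤s (m≤n+m C N₁)) N₀≤N) ⟩
    N + N                     ≡⟨ cong (N +_) (+-identityʳ N) ⟨
    2 * N                     ∎)
    where open ≤-Reasoning
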